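{- Let $a>b$ be coprime positive integers, and call an integer $k$ representable if $k=ua+vb$ for some non-negative integers $u,v$. Suppose integers $l_1<l_2<l_3$ satisfy: (1) for $1\le i\le 3$, $a<\widehat{w_i}:=ab-l_i-1<ab-1$, $l_i$ is not representable and $l_i+1$ is representable; (2) for $1\le i\le 3$, the integer $l_1+l_2+l_3-l_i-ab$ satisfies $0<l_1+l_2+l_3-l_i-ab<ab$ and is not representable; (3) $0<l_1+l_2+l_3+1-2ab<ab$ and $l_1+l_2+l_3+1-2ab$ is representable. Consider the weighted game with quota $ab$ on $3+b+a$ voters, where voter 1 has weight $\widehat{w_1}$, voter 2 has weight $\widehat{w_2}+1$, voter 3 has weight $\widehat{w_3}+1$, $b$ further voters have weight $a$ and $a$ further voters have weight $b$ (so the classes have sizes $(1,1,1,b,a)$). Then each of the following is a minimum sum representation preserving types of this game: (1) quota $ab$ and weights $\widehat{w_1},\widehat{w_2}+1,\widehat{w_3}+1$, then $b$ weights $a$ and $a$ weights $b$; (2) quota $ab$ and weights $\widehat{w_1}+1,\widehat{w_2},\widehat{w_3}+1$, then $b$ weights $a$ and $a$ weights $b$; (3) quota $ab$ and weights $\widehat{w_1}+1,\widehat{w_2}+1,\widehat{w_3}$, then $b$ weights $a$ and $a$ weights $b$.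
   Context: A weighted game with quota $q$ and non-negative weights $w_i$ declares a coalition $U$ winning iff $\sum_{i\in U}w_i\ge q$. An integer representation $[q;w_1,\dots,w_n]$ of a game has non-negative integer weights and integer quota such that winning coalitions have weight $\ge q$ and losing ones weight $\le q-1$. The types of voters are the equivalence classes of voters that are interchangeable (swapping them never changes whether a coalition wins). A minimum sum representation preserving types is an integer representation in which voters of the same type have equal weights and whose total weight $\sum_i w_i$ is minimal among all such integer representations of the game. -}

module Defs where

open import Data.Nat as ℕ using (ℕ; zero; suc)
open import Data.Integer as ℤ using (ℤ; +_; ∣_∣)
open import Data.Fin using (Fin; zero; suc; splitAt; _≟_)
open import Data.Bool using (Bool; true; false; if_then_else_)
open import Data.Sum using ([_,_])
open import Data.Product using (Σ; _×_; ∃₂)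
open import Relation.Nullary using (¬_; does)
open import Relation.Binary.PropositionalEquality using (_≡_)
open import Function using (const; _∘_)

Coalition : ℕ → Set
Coalition n = Fin n → Bool

Game : ℕ → Set₁
Game n = Coalition n → Set

wsum : ∀ {n} → (Fin n → ℕ) → Coalition n → ℕ
wsum {zero}  w U = 0
wsum {suc n} w U = (if U zero then w zero else 0) ℕ.+ wsum (w ∘ suc) (U ∘ suc)

total : ∀ {n} → (Fin n → ℕ) → ℕ
total {zero}  w = 0
total {suc n} w = w zero ℕ.+ total (w ∘ suc)

weightedGame : ∀ {n} → ℕ → (Fin n → ℕ) → Game n
weightedGame q w U = q ℕ.≤ wsum w U

transp : ∀ {n} → Fin n → Fin n → Fin n → Fin n
transp i j k = if does (k ≟ i) then j else (if does (k ≟ j) then i else k)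

SameType : ∀ {n} → Game n → Fin n → Fin n → Set
SameType G i j = ∀ U → (G U → G (U ∘ transp i j)) × (G (U ∘ transp i j) → G U)

IsIntRep : ∀ {n} → Game n → ℤ → (Fin n → ℕ) → Set
IsIntRep G q w =
  ∀ U → (G U → q ℤ.≤ + wsum w U) × (¬ G U → + wsum w U ℤ.≤ q ℤ.- ℤ.1ℤ)

PreservesTypes : ∀ {n} → Game n → (Fin n → ℕ) → Set
PreservesTypes G w = ∀ i j → SameType G i j → w i ≡ w j

IsMinSumRepPT : ∀ {n} → Game n → ℤ → (Fin n → ℕ) → Set
IsMinSumRepPT G q w =
  IsIntRep G q w × PreservesTypes G w ×
  (∀ (q' : ℤ) (w' : Fin _ → ℕ) → IsIntRep G q' w' → PreservesTypes G w' →
     total w ℕ.≤ total w')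

Representable : ℕ → ℕ → ℤ → Set
Representable a b k = ∃₂ λ (u v : ℕ) → k ≡ + (u ℕ.* a ℕ.+ v ℕ.* b)

what : ℕ → ℕ → ℤ → ℤ
what a b l = + (a ℕ.* b) ℤ.- l ℤ.- ℤ.1ℤ

Cond1 : ℕ → ℕ → ℤ → Set
Cond1 a b l =
  (+ a ℤ.< what a b l) × (what a b l ℤ.< + (a ℕ.* b) ℤ.- ℤ.1ℤ) ×
  ¬ Representable a b l × Representable a b (l ℤ.+ ℤ.1ℤ)

Cond2 : ℕ → ℕ → ℤ → ℤ → Set
Cond2 a b s li =
  let t = s ℤ.- li ℤ.- + (a ℕ.* b) in
  (ℤ.0ℤ ℤ.< t) × (t ℤ.< + (a ℕ.* b)) × ¬ Representable a b t

Cond3 : ℕ → ℕ → ℤ → Set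
Cond3 a b s =
  let t = s ℤ.+ ℤ.1ℤ ℤ.- + (2 ℕ.* (a ℕ.* b)) in
  (ℤ.0ℤ ℤ.< t) × (t ℤ.< + (a ℕ.* b)) × Representable a b t

layout : (a b : ℕ) → ℕ → ℕ → ℕ → Fin (3 ℕ.+ b ℕ.+ a) → ℕ
layout a b x y z zero = x
layout a b x y z (suc zero) = y
layout a b x y z (suc (suc zero)) = z
layout a b x y z (suc (suc (suc k))) = [ const a , const b ] (splitAt b k)

-- The three weight vectors r₁, r₂, r₃ differ only by moving one unit of weight between two of the
-- three large voters, which changes the weight of a coalition by at most one, and only for coalitions
-- containing one or two large voters; conditions (1) and (2) say that such a coalition never reaches
-- the quota ab exactly, so r₁, r₂, r₃ represent the same game.
-- The types are the five evident classes: a large voter of weight ŵᵢ together with a filler of voters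
-- of weights a and b of total weight ab − ŵᵢ wins, and stops winning when the large voter is exchanged
-- for a lighter one; the b voters of weight a win, and stop winning when one of them is exchanged for
-- a voter of weight b.
-- For minimality, a type-preserving integer representation with quota q and weights (v₁, v₂, v₃, A, B)
-- must give weight at least q to all voters of weight a, to all voters of weight b, and to the three
-- large voters with the filler of weight ab − ŵ₁ − ŵ₂ − ŵ₃ − 2 from condition (3), and less than q to a
-- coalition of r₁-weight ab − 1 (which exists as a and b are coprime). A nonnegative combination of
-- these four inequalities, i.e. a dual solution of the minimum-sum linear program, bounds
-- v₁ + v₂ + v₃ + bA + aB below by the common total weight of r₁, r₂, r₃.
module Submission where

open import Defs
open import Data.Nat using (ℕ; suc; _*_; _<_)
open import Data.Nat.Coprimality using (Coprime)
open import Data.Integer as ℤ using (ℤ; ∣_∣)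
open import Data.Product using (_×_; _,_)
open import Relation.Binary.PropositionalEquality using (refl)
import Function.Properties.Equivalence as ⇔

module WeightedGames where

  open import Data.Nat as ℕ using (zero; _+_; _≤_; z≤n)
  open import Data.Nat.Properties using (+-0-commutativeMonoid; +-assoc; +-comm; ≤-<-trans; <-irrefl; ≰⇒>)
  open import Data.Fin using (Fin; zero; suc)
  open import Data.Fin.Properties using (_≟_)
  import Data.Fin.Permutation as Perm
  import Data.Fin.Permutation.Components as PC
  open import Algebra.Properties.CommutativeMonoid.Sum +-0-commutativeMonoid using (sum; sum-permute; sum-cong-≗)
  open import Data.Bool using (true; false; if_then_else_; _∨_)
  open import Data.Product using (proj₁; proj₂; ∃-syntax)
  open import Data.Integer using (_-_; 1ℤ)
  import Data.Integer.Properties as ℤ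
  open import Relation.Nullary using (¬_; does; yes; no; contradiction)
  open import Relation.Binary.PropositionalEquality
  open import Function using (_∘_; _⇔_; Equivalence)

  wsum-cong : ∀ {n} {w w' : Fin n → ℕ} {U U' : Coalition n} →
    w ≗ w' → U ≗ U' → wsum w U ≡ wsum w' U'
  wsum-cong {zero}  w≗w' U≗U' = refl
  wsum-cong {suc n} w≗w' U≗U' =
    cong₂ _+_ (cong₂ (λ s x → if s then x else 0) (U≗U' zero) (w≗w' zero))
              (wsum-cong (w≗w' ∘ suc) (U≗U' ∘ suc))

  total-cong : ∀ {n} {f g : Fin n → ℕ} → f ≗ g → total f ≡ total g
  total-cong {zero}  f≗g = refl
  total-cong {suc n} f≗g = cong₂ _+_ (f≗g zero) (total-cong (f≗g ∘ suc))

  total≡sum : ∀ {n} (f : Fin n → ℕ) → total f ≡ sum f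
  total≡sum {zero}  f = refl
  total≡sum {suc n} f = cong (f zero +_) (total≡sum (f ∘ suc))

  wsum≡total : ∀ {n} (w : Fin n → ℕ) (U : Coalition n) →
    wsum w U ≡ total (λ k → if U k then w k else 0)
  wsum≡total {zero}  w U = refl
  wsum≡total {suc n} w U = cong ((if U zero then w zero else 0) +_) (wsum≡total (w ∘ suc) (U ∘ suc))

  weightedGame-cong : ∀ {n} (q : ℕ) (w : Fin n → ℕ) {U U' : Coalition n} →
    U ≗ U' → weightedGame q w U → weightedGame q w U'
  weightedGame-cong q w U≗U' = subst (q ≤_) (wsum-cong (λ _ → refl) U≗U')

  transp≗transpose : ∀ {n} (i j : Fin n) → transp i j ≗ PC.transpose i j
  transp≗transpose i j k with does (k ≟ i)
  ... | true  = refl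
  ... | false with does (k ≟ j)
  ...   | true  = refl
  ...   | false = refl

  transp-comm : ∀ {n} (i j : Fin n) → transp i j ≗ transp j i
  transp-comm i j k with k ≟ i | k ≟ j
  ... | yes refl | yes refl = refl
  ... | yes refl | no _     = refl
  ... | no _     | yes refl = refl
  ... | no _     | no _     = refl

  transp-target : ∀ {n} (i j : Fin n) → transp j i i ≡ j
  transp-target i j with i ≟ j
  ... | yes refl = refl
  ... | no _ with i ≟ i
  ...   | yes _  = refl
  ...   | no i≢i = contradiction refl i≢i

  wsum-∘-transp : ∀ {n} (w : Fin n → ℕ) (U : Coalition n) (i j : Fin n) →
    wsum w (U ∘ transp i j) ≡ wsum (w ∘ transp j i) U
  wsum-∘-transp w U i j = begin
    wsum w (U ∘ transp i j)                   ≡⟨ wsum-cong (λ _ → refl) (cong U ∘ transp≗transpose i j) ⟩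
    wsum w (U ∘ τ)                            ≡⟨ wsum≡total w (U ∘ τ) ⟩
    total (λ k → if U (τ k) then w k else 0)  ≡⟨ total≡sum (λ k → if U (τ k) then w k else 0) ⟩
    sum (λ k → if U (τ k) then w k else 0)    ≡⟨ sum-cong-≗ (λ k → cong (λ v → if U (τ k) then w v else 0) (sym (back k))) ⟩
    sum (g ∘ τ)                               ≡⟨ sum-permute g (Perm.transpose i j) ⟨
    sum g                                     ≡⟨ total≡sum g ⟨
    total g                                   ≡⟨ wsum≡total (w ∘ transp j i) U ⟨
    wsum (w ∘ transp j i) U                   ∎
    where
    open ≡-Reasoning
    τ = PC.transpose i j
    g = λ k → if U k then w (transp j i k) else 0
    back : ∀ k → transp j i (τ k) ≡ k
    back k = trans (transp≗transpose j i (τ k)) (PC.transpose-inverse j i)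

  SameType-sym : ∀ {n} (q : ℕ) (w : Fin n → ℕ) {i j : Fin n} →
    SameType (weightedGame q w) i j → SameType (weightedGame q w) j i
  SameType-sym q w {i} {j} st U =
      (λ g → weightedGame-cong q w (cong U ∘ transp-comm i j) (proj₁ (st U) g))
    , (λ g → proj₂ (st U) (weightedGame-cong q w (cong U ∘ transp-comm j i) g))

  ∘-transp-≗ : ∀ {n} (w : Fin n → ℕ) {i j : Fin n} → w i ≡ w j → w ∘ transp j i ≗ w
  ∘-transp-≗ w {i} {j} wi≡wj k with k ≟ j
  ... | yes refl = wi≡wj
  ... | no _ with k ≟ i
  ...   | yes refl = sym wi≡wj
  ...   | no _     = refl

  equalWeight⇒SameType : ∀ {n} (q : ℕ) (w : Fin n → ℕ) {i j : Fin n} →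
    w i ≡ w j → SameType (weightedGame q w) i j
  equalWeight⇒SameType q w {i} {j} wi≡wj U = subst (q ≤_) (sym same) , subst (q ≤_) same
    where
    same : wsum w (U ∘ transp i j) ≡ wsum w U
    same = trans (wsum-∘-transp w U i j) (wsum-cong (∘-transp-≗ w wi≡wj) (λ _ → refl))

  insert : ∀ {n} → Fin n → Coalition n → Coalition n
  insert i S k = does (k ≟ i) ∨ S k

  wsum-insert : ∀ {n} (w : Fin n → ℕ) (i : Fin n) {S : Coalition n} →
    S i ≡ false → wsum w (insert i S) ≡ w i + wsum w S
  wsum-insert w zero    {S} Si≡false rewrite Si≡false = refl
  wsum-insert w (suc i) {S} Si≡false = begin
    s₀ + wsum (w ∘ suc) (insert i (S ∘ suc))     ≡⟨ cong (s₀ +_) (wsum-insert (w ∘ suc) i Si≡false) ⟩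
    s₀ + (w (suc i) + wsum (w ∘ suc) (S ∘ suc))  ≡⟨ +-assoc s₀ _ _ ⟨
    s₀ + w (suc i) + wsum (w ∘ suc) (S ∘ suc)    ≡⟨ cong (_+ wsum (w ∘ suc) (S ∘ suc)) (+-comm s₀ (w (suc i))) ⟩
    w (suc i) + s₀ + wsum (w ∘ suc) (S ∘ suc)    ≡⟨ +-assoc (w (suc i)) s₀ _ ⟩
    w (suc i) + wsum w S                         ∎
    where
    open ≡-Reasoning
    s₀ = if S zero then w zero else 0

  wsum-∘-transp-outside : ∀ {n} (w : Fin n → ℕ) {i j : Fin n} {S : Coalition n} →
    S i ≡ false → S j ≡ false → wsum (w ∘ transp j i) S ≡ wsum w S
  wsum-∘-transp-outside w {i} {j} {S} Si Sj =
    trans (wsum≡total _ S) (trans (total-cong pointwise) (sym (wsum≡total w S)))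
    where
    pointwise : ∀ k → (if S k then w (transp j i k) else 0) ≡ (if S k then w k else 0)
    pointwise k with S k in Sk
    ... | false = refl
    ... | true with k ≟ j
    ...   | yes refl = contradiction (trans (sym Sk) Sj) λ ()
    ...   | no _ with k ≟ i
    ...     | yes refl = contradiction (trans (sym Sk) Si) λ ()
    ...     | no _     = refl

  wsum-insert-∘-transp : ∀ {n} (w : Fin n → ℕ) {i j : Fin n} {S : Coalition n} →
    S i ≡ false → S j ≡ false → wsum w (insert i S ∘ transp i j) ≡ w j + wsum w S
  wsum-insert-∘-transp w {i} {j} {S} Si Sj = begin
    wsum w (insert i S ∘ transp i j)            ≡⟨ wsum-∘-transp w (insert i S) i j ⟩
    wsum (w ∘ transp j i) (insert i S)          ≡⟨ wsum-insert (w ∘ transp j i) i Si ⟩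
    w (transp j i i) + wsum (w ∘ transp j i) S  ≡⟨ cong₂ _+_ (cong w (transp-target i j)) (wsum-∘-transp-outside w Si Sj) ⟩
    w j + wsum w S                              ∎
    where open ≡-Reasoning

  pivot⇒¬SameType : ∀ {n} (q : ℕ) (w : Fin n → ℕ) {i j : Fin n} (S : Coalition n) →
    S i ≡ false → S j ≡ false → q ≤ w i + wsum w S → w j + wsum w S < q →
    ¬ SameType (weightedGame q w) i j
  pivot⇒¬SameType q w {i} {j} S Si Sj wins loses st =
    <-irrefl refl (≤-<-trans (subst (q ≤_) (wsum-insert-∘-transp w Si Sj) swapped) loses)
    where
    swapped : q ≤ wsum w (insert i S ∘ transp i j)
    swapped = proj₁ (st (insert i S)) (subst (q ≤_) (sym (wsum-insert w i Si)) wins)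

  weightedGame⇒IsIntRep : ∀ {n} (G : Game n) (q : ℕ) (w : Fin n → ℕ) →
    (∀ U → G U ⇔ weightedGame q w U) → IsIntRep G (ℤ.+ q) w
  weightedGame⇒IsIntRep G q w G⇔ U = (ℤ.+≤+ ∘ to) , (below-quota ∘ ℤ.+<+ ∘ ≰⇒> ∘ (_∘ from))
    where
    open Equivalence (G⇔ U)
    below-quota : ∀ {i j} → i ℤ.< j → i ℤ.≤ j - 1ℤ
    below-quota {j = j} i<j = subst (_ ℤ.≤_) (ℤ.+-comm ℤ.-1ℤ j) (ℤ.i<j⇒i≤pred[j] i<j)

  natural-quota : ∀ {q m} → ℤ.+ m ℤ.≤ q - 1ℤ → ∃[ n ] q ≡ ℤ.+ n × m < n
  natural-quota {q} {m} m≤q-1 = ∣ q ∣ , sym (ℤ.0≤i⇒+∣i∣≡i 0≤q) , ℤ.drop‿+<+ (subst (ℤ.+ m ℤ.<_) (sym (ℤ.0≤i⇒+∣i∣≡i 0≤q)) m<q)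
    where
    m<q : ℤ.+ m ℤ.< q
    m<q = ℤ.i≤pred[j]⇒i<j (subst (ℤ.+ m ℤ.≤_) (ℤ.+-comm q ℤ.-1ℤ) m≤q-1)
    0≤q : ℤ.0ℤ ℤ.≤ q
    0≤q = ℤ.≤-trans (ℤ.+≤+ z≤n) (ℤ.<⇒≤ m<q)

open WeightedGames

module Coalitions where

  open import Data.Nat as ℕ using (zero; _+_; _≤_; z≤n; s≤s)
  open import Data.Nat.Properties using (+-assoc; <⇒≤)
  open import Data.Fin using (Fin; zero; suc; splitAt; _↑ˡ_; _↑ʳ_)
  open import Data.Fin.Properties using (splitAt-↑ˡ; splitAt-↑ʳ; splitAt⁻¹-↑ˡ; splitAt⁻¹-↑ʳ)
  open import Data.Bool using (Bool; true; false; if_then_else_)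
  open import Data.Sum using (inj₁; inj₂; [_,_])
  open import Data.Product using (Σ-syntax)
  open import Relation.Binary.PropositionalEquality hiding ([_])
  open import Function using (_∘_; const)

  pick : Bool → ℕ → ℕ
  pick s x = if s then x else 0

  count : ∀ {m} → Coalition m → ℕ
  count = wsum (const 1)

  wsum-const : ∀ {m} (c : ℕ) (S : Coalition m) → wsum (const c) S ≡ count S * c
  wsum-const {zero}  c S = refl
  wsum-const {suc m} c S with S zero
  ... | true  = cong (c +_) (wsum-const c (S ∘ suc))
  ... | false = wsum-const c (S ∘ suc)

  count-full : ∀ m → count {m} (const true) ≡ m
  count-full zero    = refl
  count-full (suc m) = cong suc (count-full m)

  count-empty : ∀ m → count {m} (const false) ≡ 0
  count-empty zero    = refl
  count-empty (suc m) = count-empty m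

  total≡wsum-full : ∀ {m} (w : Fin m → ℕ) → total w ≡ wsum w (const true)
  total≡wsum-full {zero}  w = refl
  total≡wsum-full {suc m} w = cong (w zero +_) (total≡wsum-full (w ∘ suc))

  subset-of-size : ∀ m {x} → x ≤ m → Σ[ S ∈ Coalition m ] count S ≡ x
  subset-of-size m       z≤n       = const false , count-empty m
  subset-of-size (suc m) (s≤s x≤m) with subset-of-size m x≤m
  ... | S , |S|≡x = (λ { zero → true ; (suc k) → S k }) , cong suc |S|≡x

  subset-of-size-avoiding : ∀ m {x} → x < m → (j : Fin m) →
    Σ[ S ∈ Coalition m ] count S ≡ x × S j ≡ false
  subset-of-size-avoiding (suc m) (s≤s x≤m) zero with subset-of-size m x≤m
  ... | S , |S|≡x = (λ { zero → false ; (suc k) → S k }) , |S|≡x , refl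
  subset-of-size-avoiding (suc m) {zero} x<m (suc j) = const false , count-empty (suc m) , refl
  subset-of-size-avoiding (suc m) {suc x} (s≤s x<m) (suc j) with subset-of-size-avoiding m x<m j
  ... | S , |S|≡x , Sj = (λ { zero → true ; (suc k) → S k }) , cong suc |S|≡x , Sj

  wsum-↑ : ∀ b a (w : Fin (b + a) → ℕ) (U : Coalition (b + a)) →
    wsum w U ≡ wsum (w ∘ (_↑ˡ a)) (U ∘ (_↑ˡ a)) + wsum (w ∘ (b ↑ʳ_)) (U ∘ (b ↑ʳ_))
  wsum-↑ zero    a w U = refl
  wsum-↑ (suc b) a w U = trans (cong (pick (U zero) (w zero) +_) (wsum-↑ b a (w ∘ suc) (U ∘ suc)))
                               (sym (+-assoc (pick (U zero) (w zero)) _ _))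

  module Layout (a b : ℕ) where

    Voter : Set
    Voter = Fin (3 + b + a)

    blockA : Fin b → Voter
    blockA i = suc (suc (suc (i ↑ˡ a)))

    blockB : Fin a → Voter
    blockB i = suc (suc (suc (b ↑ʳ i)))

    BlockUniform : (Voter → ℕ) → ℕ → ℕ → Set
    BlockUniform w A B = (∀ i → w (blockA i) ≡ A) × (∀ i → w (blockB i) ≡ B)

    layout-uniform : ∀ x y z → BlockUniform (layout a b x y z) a b
    layout-uniform x y z = (λ i → cong [ const a , const b ] (splitAt-↑ˡ b i a))
                         , (λ i → cong [ const a , const b ] (splitAt-↑ʳ b a i))

    wsum-uniform : ∀ {w A B} → BlockUniform w A B → ∀ U →
      wsum w U ≡ pick (U zero) (w zero) + (pick (U (suc zero)) (w (suc zero)) +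
        (pick (U (suc (suc zero))) (w (suc (suc zero))) + (count (U ∘ blockA) * A + count (U ∘ blockB) * B)))
    wsum-uniform {w} {A} {B} (wA , wB) U =
      cong (λ t → pick (U zero) (w zero) + (pick (U (suc zero)) (w (suc zero)) + (pick (U (suc (suc zero))) (w (suc (suc zero))) + t)))
        (trans (wsum-↑ b a (λ k → w (suc (suc (suc k)))) (λ k → U (suc (suc (suc k)))))
          (cong₂ _+_ (trans (wsum-cong {w = w ∘ blockA} wA (λ _ → refl)) (wsum-const A (U ∘ blockA)))
                     (trans (wsum-cong {w = w ∘ blockB} wB (λ _ → refl)) (wsum-const B (U ∘ blockB)))))

    wsum-layout : ∀ {x y z} (U : Coalition (3 + b + a)) →
      wsum (layout a b x y z) U ≡ pick (U zero) x + (pick (U (suc zero)) y +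
        (pick (U (suc (suc zero))) z + (count (U ∘ blockA) * a + count (U ∘ blockB) * b)))
    wsum-layout {x} {y} {z} = wsum-uniform {layout a b x y z} (layout-uniform x y z)

    total-uniform : ∀ {w A B} → BlockUniform w A B →
      total w ≡ w zero + (w (suc zero) + (w (suc (suc zero)) + (b * A + a * B)))
    total-uniform {w} {A} {B} uniform = begin
      total w              ≡⟨ total≡wsum-full w ⟩
      wsum w (const true)  ≡⟨ wsum-uniform {w} uniform (const true) ⟩
      _                    ≡⟨ cong (λ t → w zero + (w (suc zero) + (w (suc (suc zero)) + t)))
                                   (cong₂ (λ u v → u * A + v * B) (count-full b) (count-full a)) ⟩
      _                    ∎
      where open ≡-Reasoning

    coalition : Bool → Bool → Bool → Coalition b → Coalition a → Coalition (3 + b + a)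
    coalition s₁ s₂ s₃ Sa Sb zero                = s₁
    coalition s₁ s₂ s₃ Sa Sb (suc zero)          = s₂
    coalition s₁ s₂ s₃ Sa Sb (suc (suc zero))    = s₃
    coalition s₁ s₂ s₃ Sa Sb (suc (suc (suc k))) = [ Sa , Sb ] (splitAt b k)

    blocks : Coalition b → Coalition a → Coalition (3 + b + a)
    blocks = coalition false false false

    coalition-blockA : ∀ s₁ s₂ s₃ Sa Sb → coalition s₁ s₂ s₃ Sa Sb ∘ blockA ≗ Sa
    coalition-blockA s₁ s₂ s₃ Sa Sb i = cong [ Sa , Sb ] (splitAt-↑ˡ b i a)

    coalition-blockB : ∀ s₁ s₂ s₃ Sa Sb → coalition s₁ s₂ s₃ Sa Sb ∘ blockB ≗ Sb
    coalition-blockB s₁ s₂ s₃ Sa Sb i = cong [ Sa , Sb ] (splitAt-↑ʳ b a i)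

    wsum-coalition : ∀ {w A B} → BlockUniform w A B → ∀ s₁ s₂ s₃ {Sa Sb u v} → count Sa ≡ u → count Sb ≡ v →
      wsum w (coalition s₁ s₂ s₃ Sa Sb) ≡ pick s₁ (w zero) + (pick s₂ (w (suc zero)) +
        (pick s₃ (w (suc (suc zero))) + (u * A + v * B)))
    wsum-coalition {w} {A} {B} uniform s₁ s₂ s₃ {Sa} {Sb} refl refl =
      trans (wsum-uniform {w} uniform (coalition s₁ s₂ s₃ Sa Sb))
        (cong (λ t → pick s₁ (w zero) + (pick s₂ (w (suc zero)) + (pick s₃ (w (suc (suc zero))) + t)))
          (cong₂ (λ u v → u * A + v * B)
            (wsum-cong (λ _ → refl) (coalition-blockA s₁ s₂ s₃ Sa Sb))
            (wsum-cong (λ _ → refl) (coalition-blockB s₁ s₂ s₃ Sa Sb))))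

    blocks-avoiding : ∀ {u v} → u < b → v < a → (k : Voter) →
      Σ[ Sa ∈ Coalition b ] Σ[ Sb ∈ Coalition a ] count Sa ≡ u × count Sb ≡ v × blocks Sa Sb k ≡ false
    blocks-avoiding u<b v<a k with subset-of-size b (<⇒≤ u<b) | subset-of-size a (<⇒≤ v<a)
    blocks-avoiding u<b v<a zero                | Sa , |Sa| | Sb , |Sb| = Sa , Sb , |Sa| , |Sb| , refl
    blocks-avoiding u<b v<a (suc zero)          | Sa , |Sa| | Sb , |Sb| = Sa , Sb , |Sa| , |Sb| , refl
    blocks-avoiding u<b v<a (suc (suc zero))    | Sa , |Sa| | Sb , |Sb| = Sa , Sb , |Sa| , |Sb| , refl
    blocks-avoiding u<b v<a (suc (suc (suc k))) | Sa , |Sa| | Sb , |Sb| with splitAt b k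
    ... | inj₁ i with subset-of-size-avoiding b u<b i
    ...   | Sa' , |Sa'| , Sa'i = Sa' , Sb , |Sa'| , |Sb| , Sa'i
    blocks-avoiding u<b v<a (suc (suc (suc k))) | Sa , |Sa| | Sb , |Sb| | inj₂ i with subset-of-size-avoiding a v<a i
    ...   | Sb' , |Sb'| , Sb'i = Sa , Sb' , |Sa| , |Sb'| , Sb'i

    data View : Voter → Set where
      voter₁ : View zero
      voter₂ : View (suc zero)
      voter₃ : View (suc (suc zero))
      inA    : ∀ i → View (blockA i)
      inB    : ∀ i → View (blockB i)

    view : ∀ k → View k
    view zero             = voter₁
    view (suc zero)       = voter₂
    view (suc (suc zero)) = voter₃
    view (suc (suc (suc k))) with splitAt b k in eq
    ... | inj₁ i = subst (λ k → View (suc (suc (suc k)))) (splitAt⁻¹-↑ˡ eq) (inA i)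
    ... | inj₂ i = subst (λ k → View (suc (suc (suc k)))) (splitAt⁻¹-↑ʳ eq) (inB i)

open Coalitions

module Frobenius where

  open import Data.Nat as ℕ using (_+_; _∸_; _≤_; NonZero)
  open import Data.Nat.Properties
  open import Data.Nat.DivMod using (_/_; _%_; m≡m%n+[m/n]*n; m%n<n)
  open import Data.Nat.Coprimality using (coprime-Bézout)
  open import Data.Nat.GCD using (module Bézout)
  open import Data.Nat.Tactic.RingSolver using (solve-∀)
  open import Data.Product using (∃₂)
  open import Relation.Nullary using (¬_)
  open import Relation.Binary.PropositionalEquality

  CoRepresentable : ℕ → ℕ → ℕ → Set
  CoRepresentable a b m = ∃₂ λ u v → m + (u * a + v * b) ≡ a * b

  coefficients<-of-complement : ∀ {a b m u v} → 0 < m → m + (u * a + v * b) ≡ a * b → u < b × v < a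
  coefficients<-of-complement {a} {b} {m} {u} {v} 0<m eq =
      *-cancelʳ-< a u b (≤-<-trans (m≤m+n (u * a) (v * b)) (subst (u * a + v * b <_) (*-comm a b) filler<ab))
    , *-cancelʳ-< b v a (≤-<-trans (m≤n+m (v * b) (u * a)) filler<ab)
    where
    filler<ab : u * a + v * b < a * b
    filler<ab = subst (u * a + v * b <_) eq (m<n+m (u * a + v * b) 0<m)

  suc<-of-complements : ∀ {a b x y} → x < y → CoRepresentable a b y → ¬ CoRepresentable a b (suc x) → suc x < y
  suc<-of-complements {a} {b} x<y co-y ¬co-1+x =
    ≤∧≢⇒< x<y λ eq → ¬co-1+x (subst (CoRepresentable a b) (sym eq) co-y)

  bezout-reduce : ∀ {m n x y} .{{_ : NonZero n}} → 0 < m → 1 + x * m ≡ y * n →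
    ∃₂ λ x' y' → 1 + x' * m ≡ y' * n × y' ≤ m
  bezout-reduce {m} {n} {x} {y} 0<m eq = x' , y' , eq' , y'≤m
    where
    k = x / n
    x' = x % n
    y' = y ∸ k * m
    xm≡ : x * m ≡ x' * m + k * m * n
    xm≡ = trans (cong (_* m) (m≡m%n+[m/n]*n x n)) (lemma x' k n m)
      where
      lemma : ∀ x' k n m → (x' + k * n) * m ≡ x' * m + k * m * n
      lemma = solve-∀
    km≤y : k * m ≤ y
    km≤y = *-cancelʳ-≤ (k * m) y n (begin
      k * m * n           ≤⟨ m≤n+m (k * m * n) (x' * m) ⟩
      x' * m + k * m * n  ≡⟨ xm≡ ⟨
      x * m               ≤⟨ n≤1+n (x * m) ⟩
      1 + x * m           ≡⟨ eq ⟩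
      y * n               ∎)
      where open ≤-Reasoning
    eq' : 1 + x' * m ≡ y' * n
    eq' = +-cancelʳ-≡ (k * m * n) (1 + x' * m) (y' * n) (begin
      1 + x' * m + k * m * n  ≡⟨ cong suc xm≡ ⟨
      1 + x * m               ≡⟨ eq ⟩
      y * n                   ≡⟨ cong (_* n) (m+[n∸m]≡n km≤y) ⟨
      (k * m + y') * n        ≡⟨ lemma k m y' n ⟩
      y' * n + k * m * n      ∎)
      where
      open ≡-Reasoning
      lemma : ∀ k m y' n → (k * m + y') * n ≡ y' * n + k * m * n
      lemma = solve-∀
    y'≤m : y' ≤ m
    y'≤m = *-cancelʳ-≤ y' m n (begin
      y' * n      ≡⟨ eq' ⟨
      1 + x' * m  ≤⟨ +-monoˡ-≤ (x' * m) 0<m ⟩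
      suc x' * m  ≤⟨ *-monoˡ-≤ m (m%n<n x n) ⟩
      n * m       ≡⟨ *-comm n m ⟩
      m * n       ∎)
      where open ≤-Reasoning

  coprime⇒CoRepresentable-1 : ∀ {a b} → 0 < a → 0 < b → Coprime a b → CoRepresentable a b 1
  coprime⇒CoRepresentable-1 {a} {b@(suc _)} 0<a 0<b coprime with coprime-Bézout coprime
  ... | Bézout.-+ x y eq with bezout-reduce {x = x} {y} 0<a eq
  ...   | x' , y' , eq' , y'≤a = x' , a ∸ y' , (begin
    1 + (x' * a + (a ∸ y') * b)  ≡⟨ lemma x' a (a ∸ y') b ⟩
    (a ∸ y') * b + (1 + x' * a)  ≡⟨ cong ((a ∸ y') * b +_) eq' ⟩
    (a ∸ y') * b + y' * b        ≡⟨ *-distribʳ-+ b (a ∸ y') y' ⟨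
    (a ∸ y' + y') * b            ≡⟨ cong (_* b) (m∸n+n≡m y'≤a) ⟩
    a * b                        ∎)
    where
    open ≡-Reasoning
    lemma : ∀ x' a z b → 1 + (x' * a + z * b) ≡ z * b + (1 + x' * a)
    lemma = solve-∀
  coprime⇒CoRepresentable-1 {a@(suc _)} {b} 0<a 0<b coprime | Bézout.+- x y eq with bezout-reduce {x = y} {x} 0<b eq
  ...   | y' , x' , eq' , x'≤b = b ∸ x' , y' , (begin
    1 + ((b ∸ x') * a + y' * b)  ≡⟨ lemma (b ∸ x') a y' b ⟩
    (b ∸ x') * a + (1 + y' * b)  ≡⟨ cong ((b ∸ x') * a +_) eq' ⟩
    (b ∸ x') * a + x' * a        ≡⟨ *-distribʳ-+ a (b ∸ x') x' ⟨
    (b ∸ x' + x') * a            ≡⟨ cong (_* a) (m∸n+n≡m x'≤b) ⟩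
    b * a                        ≡⟨ *-comm b a ⟩
    a * b                        ∎)
    where
    open ≡-Reasoning
    lemma : ∀ z a y' b → 1 + (z * a + y' * b) ≡ z * a + (1 + y' * b)
    lemma = solve-∀

open Frobenius

module CostBound where

  open import Data.Nat as ℕ using (_+_; _≤_)
  open import Data.Nat.Properties
  open import Data.Nat.Tactic.RingSolver using (solve-∀)
  open import Relation.Binary.PropositionalEquality

  -- Weigh the three constraints by λ₁, λ₂ and λ₁ + λ₂ + 1. Matching the coefficients of A and B is
  -- a 2 × 2 linear system with determinant ab − x a − y b = 1, whose solution is λ₁, λ₂ below.
  quota-bound : ∀ {a b x y} → x ≤ b → y ≤ a → 1 + (x * a + y * b) ≡ a * b →
    ∀ p r {A B q} → q ≤ b * A → q ≤ a * B → x * A + y * B < q →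
    a * b + p * a + r * b ≤ q + p * A + r * B
  quota-bound {x = x} {y} x≤b y≤a frobenius p r {A} {B} {q} q≤bA q≤aB xA+yB<q
    with m≤n⇒∃[o]m+o≡n x≤b | m≤n⇒∃[o]m+o≡n y≤a
  ... | b' , refl | a' , refl = +-cancelʳ-≤ R T S (begin
    T + R  ≡⟨ balance ⟨
    S + L  ≤⟨ +-monoʳ-≤ S L≤R ⟩
    S + R  ∎)
    where
    open ≤-Reasoning
    a = y + a'
    b = x + b'
    λ₁ = a' * (p + x) + x * (r + y)
    λ₂ = b' * (r + y) + y * (p + x)
    λ₃ = 1 + λ₁ + λ₂
    T = a * b + p * a + r * b
    S = q + p * A + r * B
    L = λ₁ * q + λ₂ * q + λ₃ * suc (x * A + y * B)
    R = λ₁ * (b * A) + λ₂ * (a * B) + λ₃ * q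
    K = (p + x) * A + (r + y) * B + 1
    L≤R : L ≤ R
    L≤R = +-mono-≤ (+-mono-≤ (*-monoʳ-≤ λ₁ q≤bA) (*-monoʳ-≤ λ₂ q≤aB)) (*-monoʳ-≤ λ₃ xA+yB<q)
    identity : ∀ a' b' x y p r A B q →
      let a = y + a' ; b = x + b'
          λ₁ = a' * (p + x) + x * (r + y) ; λ₂ = b' * (r + y) + y * (p + x) ; λ₃ = 1 + λ₁ + λ₂
          K = (p + x) * A + (r + y) * B + 1 in
      q + p * A + r * B + (λ₁ * q + λ₂ * q + λ₃ * suc (x * A + y * B)) + a * b * K
        ≡ a * b + p * a + r * b + (λ₁ * (b * A) + λ₂ * (a * B) + λ₃ * q) + (1 + (x * a + y * b)) * K
    identity = solve-∀
    balance : S + L ≡ T + R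
    balance = +-cancelʳ-≡ (a * b * K) (S + L) (T + R)
      (trans (identity a' b' x y p r A B q) (cong (λ c → T + R + c * K) frobenius))

  cost-lower-bound : ∀ {a b x₀ y₀ x y c} → x₀ ≤ b → y₀ ≤ a → 1 + (x₀ * a + y₀ * b) ≡ a * b →
    x ≤ b → y ≤ a → c + (x * a + y * b) ≡ a * b →
    ∀ {V A B q} → q ≤ b * A → q ≤ a * B → x₀ * A + y₀ * B < q → q ≤ V + (x * A + y * B) →
    c + (b * a + a * b) ≤ V + (b * A + a * B)
  cost-lower-bound {x = x} {y} {c} x₀≤b y₀≤a frobenius x≤b y≤a tight {V} {A} {B} {q} q≤bA q≤aB x₀A+y₀B<q q≤V+xA+yB
    with m≤n⇒∃[o]m+o≡n x≤b | m≤n⇒∃[o]m+o≡n y≤a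
  ... | p , refl | r , refl = begin
    c + (b * a + a * b)                  ≡⟨ +-cancelʳ-≡ (x * a + y * b) _ _ shifted ⟩
    a * b + p * a + r * b                ≤⟨ quota-bound x₀≤b y₀≤a frobenius p r q≤bA q≤aB x₀A+y₀B<q ⟩
    q + p * A + r * B                    ≤⟨ +-monoˡ-≤ (r * B) (+-monoˡ-≤ (p * A) q≤V+xA+yB) ⟩
    V + (x * A + y * B) + p * A + r * B  ≡⟨ regroup x y p r V A B ⟩
    V + (b * A + a * B)                  ∎
    where
    open ≤-Reasoning
    a = y + r
    b = x + p
    swap : ∀ c X F → c + X + F ≡ c + F + X
    swap = solve-∀
    expand : ∀ x y p r → let a = y + r ; b = x + p in
      a * b + (b * a + a * b) ≡ a * b + p * a + r * b + (x * a + y * b)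
    expand = solve-∀
    regroup : ∀ x y p r V A B → V + (x * A + y * B) + p * A + r * B ≡ V + ((x + p) * A + (y + r) * B)
    regroup = solve-∀
    shifted : c + (b * a + a * b) + (x * a + y * b) ≡ a * b + p * a + r * b + (x * a + y * b)
    shifted = trans (swap c _ _) (trans (cong (_+ (b * a + a * b)) tight) (expand x y p r))

open CostBound

module Hypotheses where

  import Data.Nat as ℕ
  import Data.Nat.Properties as ℕ
  open import Data.Integer using (+_; _+_; _-_; 1ℤ)
  import Data.Integer.Properties as ℤ
  open import Data.Integer.Tactic.RingSolver using (solve-∀)
  open import Data.Product using (proj₁; proj₂)
  open import Relation.Nullary using (¬_)
  open import Relation.Binary.PropositionalEquality
  open import Function using (_∘′_)

  -- With wᵢ = ŵᵢ, so that lᵢ = ab − (wᵢ + 1): condition (1) says that ab − wᵢ is representable and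
  -- ab − (wᵢ + 1) is not, (2) that ab − (wⱼ + 1) − (wₖ + 1) is not representable, and (3) that
  -- ab − w₁ − (w₂ + 1) − (w₃ + 1) is.
  record Conditions (a b w₁ w₂ w₃ : ℕ) : Set where
    field
      a<w₁ : a < w₁
      a<w₂ : a < w₂
      a<w₃ : a < w₃
      w₂<w₁ : w₂ < w₁
      w₃<w₂ : w₃ < w₂
      co₁ : CoRepresentable a b w₁
      co₂ : CoRepresentable a b w₂
      co₃ : CoRepresentable a b w₃
      ¬co₁ : ¬ CoRepresentable a b (suc w₁)
      ¬co₂ : ¬ CoRepresentable a b (suc w₂)
      ¬co₃ : ¬ CoRepresentable a b (suc w₃)
      ¬co₁₂ : ¬ CoRepresentable a b (suc w₁ ℕ.+ suc w₂)
      ¬co₁₃ : ¬ CoRepresentable a b (suc w₁ ℕ.+ suc w₃)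
      ¬co₂₃ : ¬ CoRepresentable a b (suc w₂ ℕ.+ suc w₃)
      co₁₂₃ : CoRepresentable a b (w₁ ℕ.+ (suc w₂ ℕ.+ suc w₃))

  module _ {a b : ℕ} where

    private
      AB = + (a * b)

    Representable⇒CoRepresentable : ∀ {t m} → t + + m ≡ AB → Representable a b t → CoRepresentable a b m
    Representable⇒CoRepresentable {m = m} t+m≡ab (u , v , refl) =
      u , v , trans (ℕ.+-comm m (u * a ℕ.+ v * b)) (ℤ.+-injective t+m≡ab)

    CoRepresentable⇒Representable : ∀ {t m} → t + + m ≡ AB → CoRepresentable a b m → Representable a b t
    CoRepresentable⇒Representable {t} {m} t+m≡ab (u , v , eq) = u , v , (begin
      t                                ≡⟨ cancelʳ t (+ m) ⟨
      t + + m - + m                    ≡⟨ cong (_- + m) (trans t+m≡ab (cong +_ (sym eq))) ⟩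
      + m + + (u * a ℕ.+ v * b) - + m  ≡⟨ cancelˡ (+ m) (+ (u * a ℕ.+ v * b)) ⟩
      + (u * a ℕ.+ v * b)              ∎)
      where
      open ≡-Reasoning
      cancelʳ : ∀ x y → x + y - y ≡ x
      cancelʳ = solve-∀
      cancelˡ : ∀ x y → x + y - x ≡ y
      cancelˡ = solve-∀

    complement : ∀ {l} → Cond1 a b l → l + + suc ∣ what a b l ∣ ≡ AB
    complement {l} (a<ŵ , _) = begin
      l + (1ℤ + + ∣ what a b l ∣)  ≡⟨ cong (λ x → l + (1ℤ + x)) (ℤ.0≤i⇒+∣i∣≡i 0≤ŵ) ⟩
      l + (1ℤ + (AB - l - 1ℤ))     ≡⟨ lemma AB l ⟩
      AB                           ∎
      where
      open ≡-Reasoning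
      0≤ŵ = ℤ.≤-trans (ℤ.+≤+ ℕ.z≤n) (ℤ.<⇒≤ a<ŵ)
      lemma : ∀ x l → l + (1ℤ + (x - l - 1ℤ)) ≡ x
      lemma = solve-∀

    a<∣what∣ : ∀ {l} → Cond1 a b l → a < ∣ what a b l ∣
    a<∣what∣ (a<ŵ , _) = ℤ.drop‿+<+ (subst (+ a ℤ.<_) (sym (ℤ.0≤i⇒+∣i∣≡i 0≤ŵ)) a<ŵ)
      where 0≤ŵ = ℤ.≤-trans (ℤ.+≤+ ℕ.z≤n) (ℤ.<⇒≤ a<ŵ)

    complement-antitone : ∀ {l l' m m'} → l ℤ.< l' → l + + m ≡ AB → l' + + m' ≡ AB → m' < m
    complement-antitone {l} {l'} {m} {m'} l<l' eq eq' = ℤ.drop‿+<+ (begin-strict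
      + m'     ≡⟨ difference {l'} eq' ⟩
      AB - l'  <⟨ ℤ.+-monoʳ-< AB (ℤ.neg-mono-< l<l') ⟩
      AB - l   ≡⟨ difference {l} eq ⟨
      + m      ∎)
      where
      open ℤ.≤-Reasoning
      lemma : ∀ x y → y ≡ x + y - x
      lemma = solve-∀
      difference : ∀ {x y} → x + y ≡ AB → y ≡ AB - x
      difference {x} {y} eq = trans (lemma x y) (cong (_- x) eq)

    pair-complement : ∀ {lᵢ lⱼ lₖ mⱼ mₖ} (s : ℤ) → s - lᵢ ≡ lⱼ + lₖ →
      lⱼ + + mⱼ ≡ AB → lₖ + + mₖ ≡ AB → s - lᵢ - AB + + (mⱼ ℕ.+ mₖ) ≡ AB
    pair-complement {lᵢ} {lⱼ} {lₖ} {mⱼ} {mₖ} s drop eqⱼ eqₖ = begin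
      s - lᵢ - AB + (+ mⱼ + + mₖ)     ≡⟨ cong (λ x → x - AB + (+ mⱼ + + mₖ)) drop ⟩
      lⱼ + lₖ - AB + (+ mⱼ + + mₖ)    ≡⟨ lemma AB lⱼ lₖ (+ mⱼ) (+ mₖ) ⟩
      (lⱼ + + mⱼ) + (lₖ + + mₖ) - AB  ≡⟨ cong₂ (λ x y → x + y - AB) eqⱼ eqₖ ⟩
      AB + AB - AB                    ≡⟨ lemma′ AB ⟩
      AB                              ∎
      where
      open ≡-Reasoning
      lemma : ∀ z x y u v → x + y - z + (u + v) ≡ (x + u) + (y + v) - z
      lemma = solve-∀
      lemma′ : ∀ z → z + z - z ≡ z
      lemma′ = solve-∀

    triple-complement : ∀ {l₁ l₂ l₃ m₁ m₂ m₃} →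
      l₁ + + suc m₁ ≡ AB → l₂ + + m₂ ≡ AB → l₃ + + m₃ ≡ AB →
      l₁ + l₂ + l₃ + 1ℤ - + (2 * (a * b)) + + (m₁ ℕ.+ (m₂ ℕ.+ m₃)) ≡ AB
    triple-complement {l₁} {l₂} {l₃} {m₁} {m₂} {m₃} eq₁ eq₂ eq₃ = begin
      l₁ + l₂ + l₃ + 1ℤ - + (a * b ℕ.+ (a * b ℕ.+ 0)) + (+ m₁ + (+ m₂ + + m₃))
        ≡⟨ cong (λ x → l₁ + l₂ + l₃ + 1ℤ - + (a * b ℕ.+ x) + (+ m₁ + (+ m₂ + + m₃))) (ℕ.+-identityʳ (a * b)) ⟩
      l₁ + l₂ + l₃ + 1ℤ - (AB + AB) + (+ m₁ + (+ m₂ + + m₃))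
        ≡⟨ lemma AB l₁ l₂ l₃ (+ m₁) (+ m₂) (+ m₃) ⟩
      (l₁ + (1ℤ + + m₁)) + (l₂ + + m₂) + (l₃ + + m₃) - (AB + AB)
        ≡⟨ cong₂ (λ x y → x + y - (AB + AB)) (cong₂ _+_ eq₁ eq₂) eq₃ ⟩
      AB + AB + AB - (AB + AB)
        ≡⟨ lemma′ AB ⟩
      AB ∎
      where
      open ≡-Reasoning
      lemma : ∀ z x y w u v t → x + y + w + 1ℤ - (z + z) + (u + (v + t)) ≡ (x + (1ℤ + u)) + (y + v) + (w + t) - (z + z)
      lemma = solve-∀
      lemma′ : ∀ z → z + z + z - (z + z) ≡ z
      lemma′ = solve-∀

    conditions : ∀ {l₁ l₂ l₃} → l₁ ℤ.< l₂ → l₂ ℤ.< l₃ →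
      Cond1 a b l₁ → Cond1 a b l₂ → Cond1 a b l₃ →
      Cond2 a b (l₁ + l₂ + l₃) l₁ → Cond2 a b (l₁ + l₂ + l₃) l₂ → Cond2 a b (l₁ + l₂ + l₃) l₃ →
      Cond3 a b (l₁ + l₂ + l₃) →
      Conditions a b (∣ what a b l₁ ∣) (∣ what a b l₂ ∣) (∣ what a b l₃ ∣)
    conditions {l₁} {l₂} {l₃} l₁<l₂ l₂<l₃ c₁ c₂ c₃ (_ , _ , ¬r₁) (_ , _ , ¬r₂) (_ , _ , ¬r₃) (_ , _ , r₁₂₃) = record
      { a<w₁ = a<∣what∣ c₁
      ; a<w₂ = a<∣what∣ c₂
      ; a<w₃ = a<∣what∣ c₃
      ; w₂<w₁ = ℕ.≤-pred (complement-antitone l₁<l₂ e₁ e₂)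
      ; w₃<w₂ = ℕ.≤-pred (complement-antitone l₂<l₃ e₂ e₃)
      ; co₁ = co c₁
      ; co₂ = co c₂
      ; co₃ = co c₃
      ; ¬co₁ = ¬co c₁
      ; ¬co₂ = ¬co c₂
      ; ¬co₃ = ¬co c₃
      ; ¬co₁₂ = ¬r₃ ∘′ CoRepresentable⇒Representable (pair-complement {lⱼ = l₁} {l₂} s (drop₃ l₁ l₂ l₃) e₁ e₂)
      ; ¬co₁₃ = ¬r₂ ∘′ CoRepresentable⇒Representable (pair-complement {lⱼ = l₁} {l₃} s (drop₂ l₁ l₂ l₃) e₁ e₃)
      ; ¬co₂₃ = ¬r₁ ∘′ CoRepresentable⇒Representable (pair-complement {lⱼ = l₂} {l₃} s (drop₁ l₁ l₂ l₃) e₂ e₃)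
      ; co₁₂₃ = Representable⇒CoRepresentable (triple-complement {l₁} {l₂} {l₃} e₁ e₂ e₃) r₁₂₃
      }
      where
      s = l₁ + l₂ + l₃
      e₁ = complement c₁
      e₂ = complement c₂
      e₃ = complement c₃
      co : ∀ {l} (c : Cond1 a b l) → CoRepresentable a b ∣ what a b l ∣
      co {l} c = Representable⇒CoRepresentable (trans (ℤ.+-assoc l 1ℤ _) (complement c)) (proj₂ (proj₂ (proj₂ c)))
      ¬co : ∀ {l} (c : Cond1 a b l) → ¬ CoRepresentable a b (suc ∣ what a b l ∣)
      ¬co c = proj₁ (proj₂ (proj₂ c)) ∘′ CoRepresentable⇒Representable (complement c)
      drop₁ : ∀ x y z → x + y + z - x ≡ y + z
      drop₁ = solve-∀
      drop₂ : ∀ x y z → x + y + z - y ≡ x + z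
      drop₂ = solve-∀
      drop₃ : ∀ x y z → x + y + z - z ≡ x + y
      drop₃ = solve-∀

open Hypotheses

module Representations where

  open import Data.Nat as ℕ using (_+_; _≤_; z≤n; s≤s)
  open import Data.Nat.Properties
  open import Data.Fin using (zero; suc; fromℕ<)
  open import Data.Bool using (true; false)
  open import Data.Product using (proj₁; proj₂)
  open import Relation.Nullary using (¬_)
  open import Data.Empty using (⊥-elim)
  open import Relation.Binary.PropositionalEquality
  open import Function using (_∘_; _⇔_; mk⇔)

  ≤⇔≤-suc : ∀ {n x} → n ≢ suc x → n ≤ x ⇔ n ≤ suc x
  ≤⇔≤-suc n≢1+x = mk⇔ m≤n⇒m≤1+n (λ n≤1+x → ℕ.s≤s⁻¹ (≤∧≢⇒< n≤1+x n≢1+x))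

  ≡⇒≤⇔ : ∀ {n x y} → x ≡ y → n ≤ x ⇔ n ≤ y
  ≡⇒≤⇔ refl = ⇔.refl

  regroup : ∀ x y z t → x + (y + (z + t)) ≡ x + (y + z) + t
  regroup x y z t = trans (cong (x +_) (sym (+-assoc y z t))) (sym (+-assoc x (y + z) t))

  module Construction {a b w₁ w₂ w₃ : ℕ} (conditions : Conditions a b w₁ w₂ w₃)
                      (0<b : 0 < b) (b<a : b < a) (coprime : Coprime a b) where

    open Conditions conditions
    open Layout a b

    r₁ r₂ r₃ : Voter → ℕ
    r₁ = layout a b w₁ (suc w₂) (suc w₃)
    r₂ = layout a b (suc w₁) w₂ (suc w₃)
    r₃ = layout a b (suc w₁) (suc w₂) w₃

    G : Game (3 + b + a)
    G = weightedGame (a * b) r₁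

    0<a : 0 < a
    0<a = <-trans 0<b b<a

    instance
      b-nonZero : ℕ.NonZero b
      b-nonZero = ℕ.>-nonZero 0<b

    -- Moving one unit of weight between two large voters changes the weight of a coalition only if it
    -- contains exactly one of them, and then by one; the ¬co conditions say that the larger of the two
    -- weights is never ab.
    quota-invariant₂ : ∀ s₁ s₂ s₃ u v → let m = u * a + v * b in
      a * b ≤ pick s₁ w₁ + (pick s₂ (suc w₂) + (pick s₃ (suc w₃) + m)) ⇔
      a * b ≤ pick s₁ (suc w₁) + (pick s₂ w₂ + (pick s₃ (suc w₃) + m))
    quota-invariant₂ true  true  s₃    u v = ≡⇒≤⇔ (+-suc w₁ _)
    quota-invariant₂ false false s₃    u v = ≡⇒≤⇔ refl
    quota-invariant₂ true  false false u v = ≤⇔≤-suc λ eq → ¬co₁ (u , v , sym eq)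
    quota-invariant₂ true  false true  u v = ≤⇔≤-suc λ eq → ¬co₁₃ (u , v , trans (+-assoc (suc w₁) _ _) (sym eq))
    quota-invariant₂ false true  false u v = ⇔.sym (≤⇔≤-suc λ eq → ¬co₂ (u , v , sym eq))
    quota-invariant₂ false true  true  u v = ⇔.sym (≤⇔≤-suc λ eq → ¬co₂₃ (u , v , trans (+-assoc (suc w₂) _ _) (sym eq)))

    quota-invariant₃ : ∀ s₁ s₂ s₃ u v → let m = u * a + v * b in
      a * b ≤ pick s₁ w₁ + (pick s₂ (suc w₂) + (pick s₃ (suc w₃) + m)) ⇔
      a * b ≤ pick s₁ (suc w₁) + (pick s₂ (suc w₂) + (pick s₃ w₃ + m))
    quota-invariant₃ true  s₂    true  u v = ≡⇒≤⇔ (trans (cong (w₁ +_) (+-suc (pick s₂ (suc w₂)) _)) (+-suc w₁ _))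
    quota-invariant₃ false s₂    false u v = ≡⇒≤⇔ refl
    quota-invariant₃ true  false false u v = ≤⇔≤-suc λ eq → ¬co₁ (u , v , sym eq)
    quota-invariant₃ true  true  false u v = ≤⇔≤-suc λ eq → ¬co₁₂ (u , v , trans (+-assoc (suc w₁) _ _) (sym eq))
    quota-invariant₃ false false true  u v = ⇔.sym (≤⇔≤-suc λ eq → ¬co₃ (u , v , sym eq))
    quota-invariant₃ false true  true  u v = ⇔.trans (≡⇒≤⇔ (+-suc (suc w₂) _)) (⇔.sym (≤⇔≤-suc λ eq →
      ¬co₂₃ (u , v , trans (+-assoc (suc w₂) _ _) (sym (trans eq (sym (+-suc (suc w₂) _)))))))

    G⇔r₂ : ∀ U → G U ⇔ weightedGame (a * b) r₂ U
    G⇔r₂ U = subst₂ (λ x y → a * b ≤ x ⇔ a * b ≤ y) (sym (wsum-layout U)) (sym (wsum-layout U))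
      (quota-invariant₂ (U zero) (U (suc zero)) (U (suc (suc zero))) (count (U ∘ blockA)) (count (U ∘ blockB)))

    G⇔r₃ : ∀ U → G U ⇔ weightedGame (a * b) r₃ U
    G⇔r₃ U = subst₂ (λ x y → a * b ≤ x ⇔ a * b ≤ y) (sym (wsum-layout U)) (sym (wsum-layout U))
      (quota-invariant₃ (U zero) (U (suc zero)) (U (suc (suc zero))) (count (U ∘ blockA)) (count (U ∘ blockB)))

    uniform₁ : BlockUniform r₁ a b
    uniform₁ = layout-uniform w₁ (suc w₂) (suc w₃)

    Apart : Voter → Voter → Set
    Apart i j = ¬ SameType G i j × ¬ SameType G j i

    apart : ∀ {i j} → ¬ SameType G i j → Apart i j
    apart {i} {j} ¬st = ¬st , ¬st ∘ SameType-sym (a * b) r₁ {j} {i}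

    outweighs : ∀ i {W} → 0 < W → CoRepresentable a b W → W ≤ r₁ i →
      (∀ Sa Sb → blocks Sa Sb i ≡ false) → ∀ j → r₁ j < W → Apart i j
    outweighs i {W} 0<W (u , v , eq) W≤rᵢ outside j rⱼ<W with coefficients<-of-complement {u = u} {v} 0<W eq
    ... | u<b , v<a with blocks-avoiding u<b v<a j
    ...   | Sa , Sb , |Sa| , |Sb| , Sj =
      apart {i} {j} (pivot⇒¬SameType (a * b) r₁ {i} {j} (blocks Sa Sb) (outside Sa Sb) Sj wins loses)
      where
      filler : wsum r₁ (blocks Sa Sb) ≡ u * a + v * b
      filler = wsum-coalition {r₁} uniform₁ false false false |Sa| |Sb|
      wins : a * b ≤ r₁ i + wsum r₁ (blocks Sa Sb)
      wins = subst₂ _≤_ eq (cong (r₁ i +_) (sym filler)) (+-monoˡ-≤ (u * a + v * b) W≤rᵢ)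
      loses : r₁ j + wsum r₁ (blocks Sa Sb) < a * b
      loses = subst₂ _<_ (cong (r₁ j +_) (sym filler)) eq (+-monoˡ-< (u * a + v * b) rⱼ<W)

    blockA-apart-blockB : ∀ i j → Apart (blockA i) (blockB j)
    blockA-apart-blockB i j with subset-of-size-avoiding b (≤-reflexive (suc-pred b)) i
    ... | Sa , |Sa| , Sai = apart {blockA i} {blockB j} (pivot⇒¬SameType (a * b) r₁ {blockA i} {blockB j} S
          (trans (coalition-blockA false false false Sa _ i) Sai) (coalition-blockB false false false Sa _ j)
          (≤-reflexive (sym wins)) loses)
      where
      S = blocks Sa (λ _ → false)
      filler : wsum r₁ S ≡ ℕ.pred b * a + 0 * b
      filler = wsum-coalition {r₁} uniform₁ false false false |Sa| (count-empty a)
      wins : r₁ (blockA i) + wsum r₁ S ≡ a * b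
      wins = begin
        r₁ (blockA i) + wsum r₁ S  ≡⟨ cong₂ _+_ (proj₁ uniform₁ i) filler ⟩
        a + (ℕ.pred b * a + 0)     ≡⟨ cong (a +_) (+-identityʳ _) ⟩
        suc (ℕ.pred b) * a         ≡⟨ cong (_* a) (suc-pred b) ⟩
        b * a                      ≡⟨ *-comm b a ⟩
        a * b                      ∎
        where open ≡-Reasoning
      loses : r₁ (blockB j) + wsum r₁ S < a * b
      loses = subst₂ _<_ (sym (cong₂ _+_ (proj₂ uniform₁ j) filler))
        (trans (sym (cong₂ _+_ (proj₁ uniform₁ i) filler)) wins) (+-monoˡ-< (ℕ.pred b * a + 0 * b) b<a)

    outweighs₁ : ∀ j → r₁ j < w₁ → Apart zero j
    outweighs₁ = outweighs zero (≤-<-trans z≤n a<w₁) co₁ ≤-refl (λ _ _ → refl)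

    outweighs₂ : ∀ j → r₁ j < w₂ → Apart (suc zero) j
    outweighs₂ = outweighs (suc zero) (≤-<-trans z≤n a<w₂) co₂ (n≤1+n w₂) (λ _ _ → refl)

    outweighs₃ : ∀ j → r₁ j < w₃ → Apart (suc (suc zero)) j
    outweighs₃ = outweighs (suc (suc zero)) (≤-<-trans z≤n a<w₃) co₃ (n≤1+n w₃) (λ _ _ → refl)

    1+w₂<w₁ : suc w₂ < w₁
    1+w₂<w₁ = suc<-of-complements w₂<w₁ co₁ ¬co₂

    1+w₃<w₂ : suc w₃ < w₂
    1+w₃<w₂ = suc<-of-complements w₃<w₂ co₂ ¬co₃

    blockA-below : ∀ {W} i → a < W → r₁ (blockA i) < W
    blockA-below i = subst (_< _) (sym (proj₁ uniform₁ i))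

    blockB-below : ∀ {W} i → a < W → r₁ (blockB i) < W
    blockB-below i a<W = subst (_< _) (sym (proj₂ uniform₁ i)) (<-trans b<a a<W)

    SameClass : Voter → Voter → Set
    SameClass i j = ∀ x y z → layout a b x y z i ≡ layout a b x y z j

    sameType⇒sameClass : ∀ i j → SameType G i j → SameClass i j
    sameType⇒sameClass i j st with view i | view j
    ... | voter₁ | voter₁ = λ _ _ _ → refl
    ... | voter₂ | voter₂ = λ _ _ _ → refl
    ... | voter₃ | voter₃ = λ _ _ _ → refl
    ... | inA i' | inA j' = λ x y z → trans (proj₁ (layout-uniform x y z) i') (sym (proj₁ (layout-uniform x y z) j'))
    ... | inB i' | inB j' = λ x y z → trans (proj₂ (layout-uniform x y z) i') (sym (proj₂ (layout-uniform x y z) j'))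
    ... | voter₁ | voter₂ = ⊥-elim (proj₁ (outweighs₁ (suc zero) 1+w₂<w₁) st)
    ... | voter₂ | voter₁ = ⊥-elim (proj₂ (outweighs₁ (suc zero) 1+w₂<w₁) st)
    ... | voter₁ | voter₃ = ⊥-elim (proj₁ (outweighs₁ (suc (suc zero)) (<-trans 1+w₃<w₂ w₂<w₁)) st)
    ... | voter₃ | voter₁ = ⊥-elim (proj₂ (outweighs₁ (suc (suc zero)) (<-trans 1+w₃<w₂ w₂<w₁)) st)
    ... | voter₁ | inA j' = ⊥-elim (proj₁ (outweighs₁ (blockA j') (blockA-below j' a<w₁)) st)
    ... | inA j' | voter₁ = ⊥-elim (proj₂ (outweighs₁ (blockA j') (blockA-below j' a<w₁)) st)
    ... | voter₁ | inB j' = ⊥-elim (proj₁ (outweighs₁ (blockB j') (blockB-below j' a<w₁)) st)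
    ... | inB j' | voter₁ = ⊥-elim (proj₂ (outweighs₁ (blockB j') (blockB-below j' a<w₁)) st)
    ... | voter₂ | voter₃ = ⊥-elim (proj₁ (outweighs₂ (suc (suc zero)) 1+w₃<w₂) st)
    ... | voter₃ | voter₂ = ⊥-elim (proj₂ (outweighs₂ (suc (suc zero)) 1+w₃<w₂) st)
    ... | voter₂ | inA j' = ⊥-elim (proj₁ (outweighs₂ (blockA j') (blockA-below j' a<w₂)) st)
    ... | inA j' | voter₂ = ⊥-elim (proj₂ (outweighs₂ (blockA j') (blockA-below j' a<w₂)) st)
    ... | voter₂ | inB j' = ⊥-elim (proj₁ (outweighs₂ (blockB j') (blockB-below j' a<w₂)) st)
    ... | inB j' | voter₂ = ⊥-elim (proj₂ (outweighs₂ (blockB j') (blockB-below j' a<w₂)) st)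
    ... | voter₃ | inA j' = ⊥-elim (proj₁ (outweighs₃ (blockA j') (blockA-below j' a<w₃)) st)
    ... | inA j' | voter₃ = ⊥-elim (proj₂ (outweighs₃ (blockA j') (blockA-below j' a<w₃)) st)
    ... | voter₃ | inB j' = ⊥-elim (proj₁ (outweighs₃ (blockB j') (blockB-below j' a<w₃)) st)
    ... | inB j' | voter₃ = ⊥-elim (proj₂ (outweighs₃ (blockB j') (blockB-below j' a<w₃)) st)
    ... | inA i' | inB j' = ⊥-elim (proj₁ (blockA-apart-blockB i' j') st)
    ... | inB j' | inA i' = ⊥-elim (proj₂ (blockA-apart-blockB i' j') st)

    layout-preservesTypes : ∀ x y z → PreservesTypes G (layout a b x y z)
    layout-preservesTypes x y z i j st = sameType⇒sameClass i j st x y z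

    module _ {q' : ℤ} {w' : Voter → ℕ} (rep : IsIntRep G q' w') (types : PreservesTypes G w') where

      A B : ℕ
      A = w' (blockA (fromℕ< 0<b))
      B = w' (blockB (fromℕ< 0<a))

      uniform : BlockUniform w' A B
      uniform = (λ i → types _ _ (equalWeight⇒SameType (a * b) r₁ (trans (proj₁ uniform₁ i) (sym (proj₁ uniform₁ _)))))
              , (λ i → types _ _ (equalWeight⇒SameType (a * b) r₁ (trans (proj₂ uniform₁ i) (sym (proj₂ uniform₁ _)))))

      quota≤ : ∀ s₁ s₂ s₃ {Sa Sb u v} → count Sa ≡ u → count Sb ≡ v →
        a * b ≤ pick s₁ w₁ + (pick s₂ (suc w₂) + (pick s₃ (suc w₃) + (u * a + v * b))) →
        q' ℤ.≤ ℤ.+ (pick s₁ (w' zero) + (pick s₂ (w' (suc zero)) + (pick s₃ (w' (suc (suc zero))) + (u * A + v * B))))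
      quota≤ s₁ s₂ s₃ {Sa} {Sb} |Sa| |Sb| wins = subst (λ t → q' ℤ.≤ ℤ.+ t) (wsum-coalition {w'} uniform s₁ s₂ s₃ |Sa| |Sb|)
        (proj₁ (rep (coalition s₁ s₂ s₃ Sa Sb)) (subst (a * b ≤_) (sym (wsum-coalition {r₁} uniform₁ s₁ s₂ s₃ |Sa| |Sb|)) wins))

      below-quota : ∀ {Sa Sb u v} → count Sa ≡ u → count Sb ≡ v → u * a + v * b < a * b →
        ℤ.+ (u * A + v * B) ℤ.≤ q' ℤ.- ℤ.1ℤ
      below-quota {Sa} {Sb} |Sa| |Sb| loses = subst (λ t → ℤ.+ t ℤ.≤ q' ℤ.- ℤ.1ℤ) (wsum-coalition {w'} uniform false false false |Sa| |Sb|)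
        (proj₂ (rep (blocks Sa Sb)) (<⇒≱ (subst (_< a * b) (sym (wsum-coalition {r₁} uniform₁ false false false |Sa| |Sb|)) loses)))

      -- The coalitions of the bound: all voters of weight a, all voters of weight b, the three large
      -- voters with the filler x a + y b of condition (3), and a filler x₀ a + y₀ b = ab − 1.
      minimal : total r₁ ≤ total w'
      minimal with coprime⇒CoRepresentable-1 0<a 0<b coprime | co₁₂₃
      ... | x₀ , y₀ , frobenius | x , y , tight
        with coefficients<-of-complement {m = 1} {x₀} {y₀} (s≤s z≤n) frobenius
           | coefficients<-of-complement {u = x} {y} (<-≤-trans (≤-<-trans z≤n a<w₁) (m≤m+n w₁ _)) tight
      ... | x₀<b , y₀<a | x<b , y<a
        with subset-of-size b (<⇒≤ x₀<b) | subset-of-size a (<⇒≤ y₀<a)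
           | subset-of-size b (<⇒≤ x<b) | subset-of-size a (<⇒≤ y<a)
      ... | S₀a , |S₀a| | S₀b , |S₀b| | Sa , |Sa| | Sb , |Sb|
        with natural-quota (below-quota |S₀a| |S₀b| (≤-reflexive frobenius))
      ... | n , q'≡n , x₀A+y₀B<n = begin
        total r₁                                    ≡⟨ total-uniform {r₁} uniform₁ ⟩
        w₁ + (suc w₂ + (suc w₃ + (b * a + a * b)))  ≡⟨ regroup w₁ (suc w₂) (suc w₃) _ ⟩
        w₁ + (suc w₂ + suc w₃) + (b * a + a * b)    ≤⟨ cost-lower-bound {c = w₁ + (suc w₂ + suc w₃)} (<⇒≤ x₀<b) (<⇒≤ y₀<a) frobenius
                                                         (<⇒≤ x<b) (<⇒≤ y<a) tight {V = V} n≤bA n≤aB x₀A+y₀B<n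
                                                         (subst (n ≤_) (regroup v₁ v₂ v₃ _) n≤V) ⟩
        V + (b * A + a * B)                         ≡⟨ regroup v₁ v₂ v₃ _ ⟨
        v₁ + (v₂ + (v₃ + (b * A + a * B)))          ≡⟨ total-uniform {w'} uniform ⟨
        total w'                                    ∎
        where
        open ≤-Reasoning
        v₁ = w' zero
        v₂ = w' (suc zero)
        v₃ = w' (suc (suc zero))
        V = v₁ + (v₂ + v₃)
        toℕ : ∀ {t} → q' ℤ.≤ ℤ.+ t → n ≤ t
        toℕ = ℤ.drop‿+≤+ ∘ subst (ℤ._≤ _) q'≡n
        n≤bA : n ≤ b * A
        n≤bA = subst (n ≤_) (+-identityʳ (b * A)) (toℕ (quota≤ false false false (count-full b) (count-empty a)
                 (≤-reflexive (sym (trans (+-identityʳ (b * a)) (*-comm b a))))))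
        n≤aB : n ≤ a * B
        n≤aB = toℕ (quota≤ false false false (count-empty b) (count-full a) ≤-refl)
        n≤V : n ≤ v₁ + (v₂ + (v₃ + (x * A + y * B)))
        n≤V = toℕ (quota≤ true true true |Sa| |Sb| (≤-reflexive (trans (sym tight) (sym (regroup w₁ (suc w₂) (suc w₃) _)))))

    isMinSumRepPT : ∀ {x y z} → (∀ U → G U ⇔ weightedGame (a * b) (layout a b x y z) U) →
      total (layout a b x y z) ≡ total r₁ → IsMinSumRepPT G (ℤ.+ (a * b)) (layout a b x y z)
    isMinSumRepPT {x} {y} {z} G⇔ same-total =
        weightedGame⇒IsIntRep G (a * b) (layout a b x y z) G⇔
      , layout-preservesTypes x y z
      , λ q' w' rep types → subst (_≤ total w') (sym same-total) (minimal rep types)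

    total-r₂ : total r₂ ≡ total r₁
    total-r₂ = begin
      total r₂                                    ≡⟨ total-uniform {r₂} (layout-uniform (suc w₁) w₂ (suc w₃)) ⟩
      suc w₁ + (w₂ + (suc w₃ + (b * a + a * b)))  ≡⟨ +-suc w₁ _ ⟨
      w₁ + (suc w₂ + (suc w₃ + (b * a + a * b)))  ≡⟨ total-uniform {r₁} uniform₁ ⟨
      total r₁                                    ∎
      where open ≡-Reasoning

    total-r₃ : total r₃ ≡ total r₁
    total-r₃ = begin
      total r₃                                    ≡⟨ total-uniform {r₃} (layout-uniform (suc w₁) (suc w₂) w₃) ⟩
      suc w₁ + (suc w₂ + (w₃ + (b * a + a * b)))  ≡⟨ +-suc w₁ _ ⟨
      w₁ + suc (suc w₂ + (w₃ + (b * a + a * b)))  ≡⟨ cong (w₁ +_) (+-suc (suc w₂) _) ⟨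
      w₁ + (suc w₂ + (suc w₃ + (b * a + a * b)))  ≡⟨ total-uniform {r₁} uniform₁ ⟨
      total r₁                                    ∎
      where open ≡-Reasoning

open Representations

mainTheorem3 : (a b : ℕ) → 0 < b → b < a → Coprime a b →
    (l₁ l₂ l₃ : ℤ) → l₁ ℤ.< l₂ → l₂ ℤ.< l₃ →
    Cond1 a b l₁ → Cond1 a b l₂ → Cond1 a b l₃ →
    Cond2 a b (l₁ ℤ.+ l₂ ℤ.+ l₃) l₁ →
    Cond2 a b (l₁ ℤ.+ l₂ ℤ.+ l₃) l₂ →
    Cond2 a b (l₁ ℤ.+ l₂ ℤ.+ l₃) l₃ →
    Cond3 a b (l₁ ℤ.+ l₂ ℤ.+ l₃) →
    let w₁ = ∣ what a b l₁ ∣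
        w₂ = ∣ what a b l₂ ∣
        w₃ = ∣ what a b l₃ ∣
        G = weightedGame (a * b) (layout a b w₁ (suc w₂) (suc w₃))
    in IsMinSumRepPT G (ℤ.+ (a * b)) (layout a b w₁ (suc w₂) (suc w₃))
     × IsMinSumRepPT G (ℤ.+ (a * b)) (layout a b (suc w₁) w₂ (suc w₃))
     × IsMinSumRepPT G (ℤ.+ (a * b)) (layout a b (suc w₁) (suc w₂) w₃)
mainTheorem3 a b 0<b b<a coprime l₁ l₂ l₃ l₁<l₂ l₂<l₃ c₁ c₂ c₃ d₁ d₂ d₃ t =
    isMinSumRepPT (λ _ → ⇔.refl) refl
  , isMinSumRepPT G⇔r₂ total-r₂
  , isMinSumRepPT G⇔r₃ total-r₃
  where
  open Construction (conditions l₁<l₂ l₂<l₃ c₁ c₂ c₃ d₁ d₂ d₃ t) 0<b b<a coprime
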